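{- Let $G=(V,E)$ and $G'=(V',E')$ be directed acyclic graphs, let $\chi=(\mathfrak m,\mathfrak M)$ be a monitor placement for $G$, and let $f:V\to V'$ be a bijective embedding $G\hookrightarrow_f G'$; equip $G'$ with the monitor placement $\chi^f=(f(\mathfrak m),f(\mathfrak M))$. If the path set $\mathbb P(G\mid\chi)$ is routing consistent, then $\mu(G\mid\chi)\le\mu(G'\mid\chi^f)$.
   Context: For a DAG $G$, $u\preceq_G v$ means $v$ is reachable from $u$ by a directed path (including $u=v$). An embedding $f:G\hookrightarrow G'$ is an injective map $V\to V'$ such that for all $u,v\in V$, $u\preceq_G v$ iff $f(u)\preceq_{G'} f(v)$. A monitor placement $(\mathfrak m,\mathfrak M)$ specifies input nodes $\mathfrak m$ and output nodes $\mathfrak M$; $\mathbb P(G\mid\chi)$ is the set of directed measurement paths from a node of $\mathfrak m$ to a node of $\mathfrak M$ (under $\mathrm{CSP}$: simple paths with distinct endpoints; under $\mathrm{CAP}^-$: all such directed walks except single-node paths on a node of $\mathfrak m\cap\mathfrak M$). A set of paths $\mathbb P$ is routing consistent if for any two distinct paths $p,p'\in\mathbb P$ and any distinct nodes $u,w$ traversed by both, $p$ and $p'$ follow the same subpath between $u$ and $w$. $\mathbb P(v)$ is the set of paths through $v$, $\mathbb P(U)=\bigcup_{u\in U}\mathbb P(u)$; $V$ is $k$-identifiable if for all $U,W\subseteq V$, $U\ne W$, $|U|,|W|\le k$, $\mathbb P(U)\neq\mathbb P(W)$; $\mu$ is the largest such $k\ge0$. -}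

module Defs where

open import Level using (0ℓ)
open import Data.Nat using (ℕ; _≤_)
open import Data.Fin using (Fin)
open import Data.Fin.Subset using (Subset; _∈_; ∣_∣)
open import Data.List using (List; []; _∷_; _++_; _∷ʳ_)
import Data.List.Membership.Propositional as LM
open import Data.List.Relation.Unary.Unique.Propositional using (Unique)
open import Data.Product using (Σ; ∃; ∃₂; _×_; _,_)
open import Data.Sum using (_⊎_)
open import Relation.Nullary using (¬_)
open import Relation.Unary using (Pred)
open import Relation.Binary.PropositionalEquality using (_≡_; _≢_)
open import Relation.Binary.Construct.Closure.ReflexiveTransitive using (Star)
open import Function.Bundles using (_⇔_)

Digraph : ℕ → Set₁
Digraph n = Fin n → Fin n → Set

_⊢_⪯_ : ∀ {n} → Digraph n → Fin n → Fin n → Set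
E ⊢ u ⪯ v = Star E u v

Acyclic : ∀ {n} → Digraph n → Set
Acyclic {n} E = ∀ (u v : Fin n) → E u v → ¬ (Star E v u)

record MonitorPlacement (n : ℕ) : Set₁ where
  constructor ⟨_,_⟩
  field
    inputs  : Pred (Fin n) 0ℓ
    outputs : Pred (Fin n) 0ℓ
open MonitorPlacement public

image : ∀ {n n'} → (Fin n → Fin n') → Pred (Fin n) 0ℓ → Pred (Fin n') 0ℓ
image f S v' = ∃ λ v → S v × f v ≡ v'

_^_ : ∀ {n n'} → MonitorPlacement n → (Fin n → Fin n') → MonitorPlacement n'
χ ^ f = ⟨ image f (inputs χ) , image f (outputs χ) ⟩

data DPath {n} (E : Digraph n) : Fin n → Fin n → List (Fin n) → Set where
  [_] : ∀ v → DPath E v v (v ∷ [])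
  _∷_ : ∀ {u v w vs} → E u v → DPath E v w vs → DPath E u w (u ∷ vs)

MPath : ∀ {n} → Digraph n → MonitorPlacement n → List (Fin n) → Set
MPath E χ p = ∃₂ λ s t → inputs χ s × outputs χ t × s ≢ t × DPath E s t p × Unique p

InPU : ∀ {n} → Digraph n → MonitorPlacement n → Subset n → List (Fin n) → Set
InPU E χ U p = MPath E χ p × ∃ λ u → u ∈ U × u LM.∈ p

Identifiable : ∀ {n} → Digraph n → MonitorPlacement n → ℕ → Set
Identifiable {n} E χ k =
  ∀ (U W : Subset n) → U ≢ W → ∣ U ∣ ≤ k → ∣ W ∣ ≤ k →
  ¬ (∀ (p : List (Fin n)) → InPU E χ U p ⇔ InPU E χ W p)

SubpathBetween : ∀ {n} → List (Fin n) → Fin n → Fin n → List (Fin n) → Set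
SubpathBetween p a b q =
  (∃₂ λ xs ys → p ≡ xs ++ q ++ ys) ×
  ((∃ λ mid → q ≡ a ∷ (mid ∷ʳ b)) ⊎ (∃ λ mid → q ≡ b ∷ (mid ∷ʳ a)))

RoutingConsistent : ∀ {n} → Digraph n → MonitorPlacement n → Set
RoutingConsistent {n} E χ =
  ∀ (p p' : List (Fin n)) → MPath E χ p → MPath E χ p' → p ≢ p' →
  ∀ (u w : Fin n) → u ≢ w →
  u LM.∈ p → w LM.∈ p → u LM.∈ p' → w LM.∈ p' →
  ∀ (q q' : List (Fin n)) → SubpathBetween p u w q → SubpathBetween p' u w q' → q ≡ q'

Embedding : ∀ {n n'} → Digraph n → Digraph n' → (Fin n → Fin n') → Set
Embedding {n} E E' f =
  (∀ {u v : Fin n} → f u ≡ f v → u ≡ v) ×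
  (∀ (u v : Fin n) → (E ⊢ u ⪯ v) ⇔ (E' ⊢ f u ⪯ f v))

-- μ(G|χ) ≤ μ(G'|χ') : since k-identifiability is downward closed in k, this says
-- every k for which G|χ is k-identifiable also makes G'|χ' k-identifiable
-- (correct also when μ is unbounded).
μ≤ : ∀ {n n'} → Digraph n → MonitorPlacement n → Digraph n' → MonitorPlacement n' → Set
μ≤ E χ E' χ' = ∀ (k : ℕ) → Identifiable E χ k → Identifiable E' χ' k

module Submission where

-- The heart of the argument is
-- that f maps every measurement path of G to a measurement path of G': for an
-- edge a → b of a measurement path p, we have f a ⪯ f b in G'; if this were not
-- an edge, surjectivity would give a vertex x of G strictly between a and b, and
-- rerouting p through x would give a second measurement path that joins a and b
-- by a different subpath, against routing consistency.
--
-- Hence, for vertex sets U', W' of G' with preimages U, W, a path p of G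
-- through U yields the path f p of G' through U'.  So 𝕡(U') = 𝕡(W') forces
-- 𝕡(U) = 𝕡(W); since f is a bijection, U' ≠ W' gives U ≠ W and |U| ≤ |U'|.

open import Defs
open import Data.Nat using (ℕ; _≤_; z≤n; s≤s)
open import Data.Nat.Properties using (≤-trans)
open import Data.Fin using (Fin; zero; suc; _≟_)
open import Data.Fin.Properties using (suc-injective; 0≢1+n)
open import Data.Fin.Subset using (Subset; inside; outside; _-_; _∈_; ∣_∣)
open import Data.Fin.Subset.Properties using (x∈p∧x≢y⇒x∈p-y; x∈p⇒∣p-x∣<∣p∣)
open import Data.Vec using ([]; _∷_; lookup; tabulate; here; there)
open import Data.Vec.Properties
  using ([]=⇒lookup; lookup⇒[]=; lookup∘tabulate; tabulate∘lookup; tabulate-cong)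
open import Data.List using (List; []; _∷_; _++_; _∷ʳ_; map)
open import Data.List.Properties using (≡-dec; ++-cancelˡ; ++-cancelʳ; ++-assoc)
open import Data.List.Membership.Propositional using () renaming (_∈_ to _∈ₗ_)
open import Data.List.Membership.Propositional.Properties using (∈-map⁺; ∈-map⁻; ∈-++⁺ˡ; ∈-++⁺ʳ)
open import Data.List.Relation.Unary.Any using (here; there)
import Data.List.Relation.Unary.All as All
open import Data.List.Relation.Unary.AllPairs using ([]; _∷_)
open import Data.List.Relation.Unary.Unique.Propositional using (Unique)
open import Data.List.Relation.Unary.Unique.Propositional.Properties using () renaming (map⁺ to Unique-map⁺)
open import Data.Product using (∃; _×_; _,_; proj₁; proj₂)
open import Data.Sum using (_⊎_; inj₁; inj₂)
open import Data.Empty using (⊥-elim)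
open import Relation.Nullary using (Dec; yes; no)
open import Relation.Binary.PropositionalEquality
  using (_≡_; _≢_; refl; sym; trans; cong; subst; module ≡-Reasoning)
open import Relation.Binary.Construct.Closure.ReflexiveTransitive using (Star; ε; _◅_)
open import Function using (_∘_; id)
open import Function.Bundles using (mk⇔; Equivalence)

∣∣-mono-injection : ∀ {n m} (g : Fin n → Fin m) → (∀ {x y} → g x ≡ g y → x ≡ y) →
  (P : Subset n) (Q : Subset m) → (∀ i → i ∈ P → g i ∈ Q) → ∣ P ∣ ≤ ∣ Q ∣
∣∣-mono-injection g injective [] Q into = z≤n
∣∣-mono-injection g injective (outside ∷ P) Q into =
  ∣∣-mono-injection (g ∘ suc) (suc-injective ∘ injective) P Q (λ i i∈P → into (suc i) (there i∈P))
∣∣-mono-injection g injective (inside ∷ P) Q into =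
  ≤-trans (s≤s (∣∣-mono-injection (g ∘ suc) (suc-injective ∘ injective) P (Q - g zero) into-rest))
          (x∈p⇒∣p-x∣<∣p∣ (into zero here))
  where
  into-rest : ∀ i → i ∈ P → g (suc i) ∈ Q - g zero
  into-rest i i∈P = x∈p∧x≢y⇒x∈p-y (into (suc i) (there i∈P)) (λ eq → 0≢1+n (sym (injective eq)))

preimage : ∀ {n n'} → (Fin n → Fin n') → Subset n' → Subset n
preimage f U' = tabulate (λ i → lookup U' (f i))

module _ {n n'} (f : Fin n → Fin n') (U' : Subset n') where

  lookup-preimage : ∀ i → lookup (preimage f U') i ≡ lookup U' (f i)
  lookup-preimage = lookup∘tabulate (λ i → lookup U' (f i))

  ∈-preimage⁻ : ∀ {i} → i ∈ preimage f U' → f i ∈ U'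
  ∈-preimage⁻ {i} i∈ = lookup⇒[]= (f i) U' (trans (sym (lookup-preimage i)) ([]=⇒lookup i∈))

  ∈-preimage⁺ : ∀ {i} → f i ∈ U' → i ∈ preimage f U'
  ∈-preimage⁺ {i} fi∈ = lookup⇒[]= i _ (trans (lookup-preimage i) ([]=⇒lookup fi∈))

preimage-injective : ∀ {n n'} (f : Fin n → Fin n') → (∀ v' → ∃ λ v → f v ≡ v') →
  ∀ {U' W'} → preimage f U' ≡ preimage f W' → U' ≡ W'
preimage-injective f surjective {U'} {W'} same = begin
  U'                   ≡⟨ sym (tabulate∘lookup U') ⟩
  tabulate (lookup U') ≡⟨ tabulate-cong pointwise ⟩
  tabulate (lookup W') ≡⟨ tabulate∘lookup W' ⟩
  W'                   ∎
  where
  open ≡-Reasoning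
  pointwise : ∀ v' → lookup U' v' ≡ lookup W' v'
  pointwise v' with surjective v'
  ... | v , refl = begin
    lookup U' (f v)          ≡⟨ sym (lookup-preimage f U' v) ⟩
    lookup (preimage f U') v ≡⟨ cong (λ S → lookup S v) same ⟩
    lookup (preimage f W') v ≡⟨ lookup-preimage f W' v ⟩
    lookup W' (f v)          ∎

module Walks {n : ℕ} (E : Digraph n) where

  walk-head : ∀ {a b vs} → DPath E a b vs → ∃ λ ys → vs ≡ a ∷ ys
  walk-head [ a ]   = [] , refl
  walk-head (e ∷ d) = _ , refl

  star→walk : ∀ {a b} → E ⊢ a ⪯ b → ∃ λ ys → DPath E a b (a ∷ ys)
  star→walk {a} ε = [] , [ a ]
  star→walk (e ◅ r) with star→walk r
  ... | ys , d = _ , e ∷ d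

  walk-join : ∀ {a b c vs ys} → DPath E a b vs → DPath E b c (b ∷ ys) → DPath E a c (vs ++ ys)
  walk-join [ _ ]    d = d
  walk-join (e ∷ d₁) d = e ∷ walk-join d₁ d

  walk-member-reachable : ∀ {a b vs x} → DPath E a b vs → x ∈ₗ vs → E ⊢ a ⪯ x
  walk-member-reachable [ _ ]   (here refl) = ε
  walk-member-reachable (e ∷ d) (here refl) = ε
  walk-member-reachable (e ∷ d) (there x∈) = e ◅ walk-member-reachable d x∈

  walk-target-member : ∀ {a b vs} → DPath E a b vs → b ∈ₗ vs
  walk-target-member [ _ ]   = here refl
  walk-target-member (e ∷ d) = there (walk-target-member d)

  acyclic-walk-unique : Acyclic E → ∀ {a b vs} → DPath E a b vs → Unique vs
  acyclic-walk-unique acyclic [ _ ] = All.[] ∷ []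
  acyclic-walk-unique acyclic (_∷_ {u} {v} e d) =
    All.tabulate (λ x∈ u≡x → acyclic u v e (subst (Star E v) (sym u≡x) (walk-member-reachable d x∈)))
      ∷ acyclic-walk-unique acyclic d

  walk-last : ∀ {a b vs} → DPath E a b vs → ∃ λ init → vs ≡ init ∷ʳ b
  walk-last [ b ] = [] , refl
  walk-last {a} (e ∷ d) with walk-last d
  ... | init , refl = a ∷ init , refl

  walk-shape : ∀ {a b vs} → DPath E a b vs → a ≢ b → ∃ λ mid → vs ≡ a ∷ (mid ∷ʳ b)
  walk-shape [ _ ] a≢a = ⊥-elim (a≢a refl)
  walk-shape (e ∷ d) a≢b with walk-last d
  ... | mid , refl = mid , refl

  -- `Prefix s a pre`: the vertex list pre leads from s to just before a, so
  -- that any walk from a extends to a walk from s by prepending pre.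
  Prefix : Fin n → Fin n → List (Fin n) → Set
  Prefix s a pre = ∀ {t vs} → DPath E a t vs → DPath E s t (pre ++ vs)

  prefix-extend : ∀ {s a b pre} → Prefix s a pre → E a b → Prefix s b (pre ∷ʳ a)
  prefix-extend {a = a} {pre = pre} ctx e {vs = vs} d =
    subst (DPath E _ _) (sym (++-assoc pre (a ∷ []) vs)) (ctx (e ∷ d))

edge-irreflexive : ∀ {n} {R : Digraph n} → Acyclic R → ∀ {u v} → R u v → u ≢ v
edge-irreflexive acyclic {u} {v} e u≡v = acyclic u v e (subst (Star _ v) (sym u≡v) ε)

reachability-trichotomy : ∀ {n} {R : Digraph n} → Acyclic R → ∀ {x y} → R ⊢ x ⪯ y →
  x ≡ y ⊎ R x y ⊎ ∃ λ m → m ≢ x × m ≢ y × R ⊢ x ⪯ m × R ⊢ m ⪯ y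
reachability-trichotomy acyclic ε = inj₁ refl
reachability-trichotomy acyclic (e ◅ ε) = inj₂ (inj₁ e)
reachability-trichotomy {R = R} acyclic (_◅_ {j = m} e (_◅_ {j = m₂} e₂ r)) =
  inj₂ (inj₂ (m , edge-irreflexive acyclic e ∘ sym , m≢y , e ◅ ε , e₂ ◅ r))
  where
  m≢y : m ≢ _
  m≢y m≡y = acyclic m m₂ e₂ (subst (Star R m₂) (sym m≡y) r)

∈-pair : ∀ {n} {x a b : Fin n} → x ∈ₗ a ∷ b ∷ [] → x ≡ a ⊎ x ≡ b
∈-pair (here x≡a)         = inj₁ x≡a
∈-pair (there (here x≡b)) = inj₂ x≡b

module RoutingConsistency {n} {E : Digraph n} {χ : MonitorPlacement n}
    (acyclic : Acyclic E) (consistent : RoutingConsistent E χ)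
    {s t : Fin n} (s∈𝔪 : inputs χ s) (t∈𝔐 : outputs χ t) (s≢t : s ≢ t) where

  open Walks E

  measurement : ∀ {p} → DPath E s t p → MPath E χ p
  measurement d = s , t , s∈𝔪 , t∈𝔐 , s≢t , d , acyclic-walk-unique acyclic d

  -- An edge a → b on a measurement path is the only route from a to b:
  -- rerouting the path along another walk Q from a to b yields a second
  -- measurement path, and routing consistency forces Q to be a, b.
  only-route : ∀ {a b pre vs Q} → Prefix s a pre → E a b → DPath E b t vs →
    DPath E a b Q → Q ≡ a ∷ b ∷ []
  only-route {a} {b} {pre} ctx e d dQ with walk-head d | walk-head dQ
  ... | ys , refl | Qt , refl = by-cases (≡-dec _≟_ p p″)
    where
    p p″ : List (Fin n)
    p  = pre ++ a ∷ b ∷ ys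
    p″ = pre ++ (a ∷ Qt) ++ ys
    a≢b : a ≢ b
    a≢b = edge-irreflexive acyclic e
    by-cases : Dec (p ≡ p″) → a ∷ Qt ≡ a ∷ b ∷ []
    by-cases (yes p≡p″) = sym (++-cancelʳ ys (a ∷ b ∷ []) (a ∷ Qt) (++-cancelˡ pre _ _ p≡p″))
    by-cases (no p≢p″) =
      sym (consistent p p″ (measurement (ctx (e ∷ d))) (measurement (ctx (walk-join dQ d)))
             p≢p″ a b a≢b
             (∈-++⁺ʳ pre (here refl)) (∈-++⁺ʳ pre (there (here refl)))
             (∈-++⁺ʳ pre (here refl)) (∈-++⁺ʳ pre (∈-++⁺ˡ (walk-target-member dQ)))
             (a ∷ b ∷ []) (a ∷ Qt)
             ((pre , ys , refl) , inj₁ ([] , refl))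
             ((pre , ys , refl) , inj₁ (walk-shape dQ a≢b)))

  nothing-between : ∀ {a b pre vs x} → Prefix s a pre → E a b → DPath E b t vs →
    E ⊢ a ⪯ x → E ⊢ x ⪯ b → x ≡ a ⊎ x ≡ b
  nothing-between {x = x} ctx e d a⪯x x⪯b with star→walk a⪯x | star→walk x⪯b
  ... | _ , d₁ | _ , d₂ =
    ∈-pair (subst (x ∈ₗ_) (only-route ctx e d (walk-join d₁ d₂)) (∈-++⁺ˡ (walk-target-member d₁)))

module EdgeReflection {n n'} {E : Digraph n} {E' : Digraph n'} {f : Fin n → Fin n'}
    (acyclic' : Acyclic E') (embedding : Embedding E E' f)
    (surjective : ∀ v' → ∃ λ v → f v ≡ v') where

  injective : ∀ {u v} → f u ≡ f v → u ≡ v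
  injective = proj₁ embedding

  -- If b is reachable from a ≠ b in G with no vertex strictly in between,
  -- then f a → f b is an edge of G': a longer route in G' would pass a
  -- vertex f x, and x would lie strictly between a and b.
  edge-reflected : ∀ {a b} → E ⊢ a ⪯ b → a ≢ b →
    (∀ x → E ⊢ a ⪯ x → E ⊢ x ⪯ b → x ≡ a ⊎ x ≡ b) → E' (f a) (f b)
  edge-reflected {a} {b} a⪯b a≢b between
    with reachability-trichotomy acyclic' (Equivalence.to (proj₂ embedding a b) a⪯b)
  ... | inj₁ fa≡fb = ⊥-elim (a≢b (injective fa≡fb))
  ... | inj₂ (inj₁ edge) = edge
  ... | inj₂ (inj₂ (m , m≢fa , m≢fb , fa⪯m , m⪯fb)) with surjective m
  ... | x , refl with between x (Equivalence.from (proj₂ embedding a x) fa⪯m)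
                                (Equivalence.from (proj₂ embedding x b) m⪯fb)
  ... | inj₁ refl = ⊥-elim (m≢fa refl)
  ... | inj₂ refl = ⊥-elim (m≢fb refl)

module MeasurementImage {n n'} {E : Digraph n} {E' : Digraph n'} {χ : MonitorPlacement n}
    {f : Fin n → Fin n'} (acyclic : Acyclic E) (acyclic' : Acyclic E')
    (embedding : Embedding E E' f) (surjective : ∀ v' → ∃ λ v → f v ≡ v')
    (consistent : RoutingConsistent E χ) where

  open Walks E using (Prefix; prefix-extend)
  open EdgeReflection acyclic' embedding surjective

  map-walk : ∀ {s t} → inputs χ s → outputs χ t → s ≢ t →
    ∀ {a pre vs} → Prefix s a pre → DPath E a t vs → DPath E' (f a) (f t) (map f vs)
  map-walk s∈𝔪 t∈𝔐 s≢t ctx [ a ] = [ f a ]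
  map-walk s∈𝔪 t∈𝔐 s≢t ctx (e ∷ d) =
    edge-reflected (e ◅ ε) (edge-irreflexive acyclic e) (λ x → nothing-between ctx e d)
      ∷ map-walk s∈𝔪 t∈𝔐 s≢t (prefix-extend ctx e) d
    where open RoutingConsistency acyclic consistent s∈𝔪 t∈𝔐 s≢t

  measurement-image : ∀ {p} → MPath E χ p → MPath E' (χ ^ f) (map f p)
  measurement-image (s , t , s∈𝔪 , t∈𝔐 , s≢t , d , unique) =
    f s , f t , (s , s∈𝔪 , refl) , (t , t∈𝔐 , refl) , s≢t ∘ injective ,
    map-walk s∈𝔪 t∈𝔐 s≢t id d , Unique-map⁺ injective unique

  pathset-pullback : ∀ U' W' →
    (∀ p' → InPU E' (χ ^ f) U' p' → InPU E' (χ ^ f) W' p') →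
    ∀ p → InPU E χ (preimage f U') p → InPU E χ (preimage f W') p
  pathset-pullback U' W' U'⊆W' p (mp , u , u∈U , u∈p)
    with U'⊆W' (map f p) (measurement-image mp , f u , ∈-preimage⁻ f U' u∈U , ∈-map⁺ f u∈p)
  ... | _ , w' , w'∈W' , w'∈fp with ∈-map⁻ f w'∈fp
  ... | w , w∈p , refl = mp , w , ∈-preimage⁺ f W' w'∈W' , w∈p

-- Distinct sets U', W' of size ≤ k in G' with equal path sets would give the
-- distinct preimages f⁻¹U', f⁻¹W' of size ≤ k in G with equal path sets.
theorem7 : ∀ {n n' : ℕ} (E : Digraph n) (E' : Digraph n') (χ : MonitorPlacement n)
           (f : Fin n → Fin n') →
           Acyclic E → Acyclic E' →
           Embedding E E' f → (∀ (v' : Fin n') → ∃ λ v → f v ≡ v') →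
           RoutingConsistent E χ →
           μ≤ E χ E' (χ ^ f)
theorem7 E E' χ f acyclic acyclic' embedding surjective consistent
         k identifiable U' W' U'≢W' ∣U'∣≤k ∣W'∣≤k same-paths =
  identifiable (preimage f U') (preimage f W')
    (U'≢W' ∘ preimage-injective f surjective)
    (≤-trans (∣preimage∣≤ U') ∣U'∣≤k) (≤-trans (∣preimage∣≤ W') ∣W'∣≤k)
    (λ p → mk⇔ (pathset-pullback U' W' (Equivalence.to ∘ same-paths) p)
                (pathset-pullback W' U' (Equivalence.from ∘ same-paths) p))
  where
  open MeasurementImage acyclic acyclic' embedding surjective consistent
  open EdgeReflection acyclic' embedding surjective using (injective)
  ∣preimage∣≤ : ∀ V' → ∣ preimage f V' ∣ ≤ ∣ V' ∣
  ∣preimage∣≤ V' = ∣∣-mono-injection f injective (preimage f V') V' (λ i → ∈-preimage⁻ f V')
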